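{- Let $\mathbb{K}=(G,M,I)$ be a formal context and $\mathbb{S}=[H,N]$ a subcontext of $\mathbb{K}$ with incidence $J=I\cap(H\times N)$. Then $\phi_1(\mathbb{S})=\phi_2(\mathbb{S})$ holds if and only if $(A'\setminus B)\times(B'\setminus A)\subseteq I$ for all formal concepts $(A,B)$ of $\mathbb{S}$. Moreover, if for every concept $(A,B)$ of $\mathbb{S}$ one of the following three cases holds, then $\phi_1(\mathbb{S})=\phi_2(\mathbb{S})$: (1) $A'=A^J=B$ and $B'=B^J=A$; (2) $A'=A^J=B$ and $A=B^J\subsetneq B'$; (3) $B=A^J\subsetneq A'$ and $B'=B^J=A$.
   Context: All sets are finite. A formal context $\mathbb{K}=(G,M,I)$ has finite $G$, $M$, $I\subseteq G\times M$; for $A\subseteq G$, $A'=\{m\in M\mid\forall g\in A:(g,m)\in I\}$, for $B\subseteq M$, $B'=\{g\in G\mid\forall m\in B:(g,m)\in I\}$; $A^J$, $B^J$ denote the analogous derivations in $\mathbb{S}$ with respect to $J$. Formal concepts of $\mathbb{S}$ are pairs $(A,B)$ with $A^J=B$, $B^J=A$. For a concept $(A,B)$ of $\mathbb{S}$, $\phi_1(A,B)=(A'',A')$ and $\phi_2(A,B)=(B',B'')$ (derivations in $\mathbb{K}$; these are concepts of $\mathbb{K}$), and $\phi_i(\mathbb{S})$ denotes the suborder $\{\phi_i(C)\mid C \text{ a concept of } \mathbb{S}\}$ of the concept lattice of $\mathbb{K}$. -}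

module Defs where

open import Data.Nat using (ℕ; zero; suc)
open import Data.Bool using (Bool; true; false; _∧_; _∨_; not)
open import Data.Fin using (Fin; zero; suc)
open import Data.Fin.Subset using (Subset; _∈_; _─_; _⊂_; inside)
open import Data.Vec using (lookup; tabulate)
open import Data.Product using (Σ; ∃; _×_; _,_)
open import Data.Sum using (_⊎_)
open import Function using (_∘_)
open import Relation.Binary.PropositionalEquality using (_≡_)

allFin : ∀ {n} → (Fin n → Bool) → Bool
allFin {zero}  f = true
allFin {suc n} f = f zero ∧ allFin (f ∘ suc)

_⇒ᵇ_ : Bool → Bool → Bool
a ⇒ᵇ b = not a ∨ b

-- A finite formal context K = (G, M, I) with G = Fin nG, M = Fin nM;
-- I g is the set of attributes of object g, so (g , m) ∈ I  iff  m ∈ I g.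
record Context : Set where
  field
    nG nM : ℕ
    I     : Fin nG → Subset nM

module _ (K : Context) where
  open Context K

  extent′ : Subset nG → Subset nM
  extent′ A = tabulate λ m → allFin λ g → lookup A g ⇒ᵇ lookup (I g) m

  intent′ : Subset nM → Subset nG
  intent′ B = tabulate λ g → allFin λ m → lookup B m ⇒ᵇ lookup (I g) m

  -- Subcontext S = [H , N] with J = I ∩ (H × N).
  -- A^J = { n ∈ N | ∀ g ∈ A, (g , n) ∈ J }
  -- (for A ⊆ H this is exactly the derivation in S; in general we use J literally)
  extentJ : Subset nG → Subset nG → Subset nM → Subset nM
  extentJ H A N = tabulate λ m → lookup N m ∧ (allFin λ g → lookup A g ⇒ᵇ
                     (lookup H g ∧ lookup N m ∧ lookup (I g) m))

  intentJ : Subset nG → Subset nM → Subset nM → Subset nG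
  intentJ H N B = tabulate λ g → lookup H g ∧ (allFin λ m → lookup B m ⇒ᵇ
                     (lookup H g ∧ lookup N m ∧ lookup (I g) m))

  record SConcept (H : Subset nG) (N : Subset nM) : Set where
    constructor sconcept
    field
      ext  : Subset nG
      int  : Subset nM
      ext-J : extentJ H ext N ≡ int
      int-J : intentJ H N int ≡ ext

  KPair : Set
  KPair = Subset nG × Subset nM

  φ₁ : ∀ {H N} → SConcept H N → KPair
  φ₁ C = intent′ (extent′ A) , extent′ A
    where A = SConcept.ext C

  φ₂ : ∀ {H N} → SConcept H N → KPair
  φ₂ C = intent′ B , extent′ (intent′ B)
    where B = SConcept.int C

  φ₁S≡φ₂S : Subset nG → Subset nM → Set
  φ₁S≡φ₂S H N =
    ((C : SConcept H N) → Σ (SConcept H N) λ D → φ₁ C ≡ φ₂ D) ×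
    ((D : SConcept H N) → Σ (SConcept H N) λ C → φ₂ D ≡ φ₁ C)

  CrossCond : ∀ {H N} → SConcept H N → Set
  CrossCond C = ∀ (m : Fin nM) (g : Fin nG) →
    m ∈ (extent′ A ─ B) → g ∈ (intent′ B ─ A) → m ∈ I g
    where A = SConcept.ext C
          B = SConcept.int C

  ThreeCases : ∀ {H N} → SConcept H N → Set
  ThreeCases {H} {N} C =
      (extent′ A ≡ extentJ H A N × extentJ H A N ≡ B ×
       intent′ B ≡ intentJ H N B × intentJ H N B ≡ A)
    ⊎ ((extent′ A ≡ extentJ H A N × extentJ H A N ≡ B) ×
       (A ≡ intentJ H N B × intentJ H N B ⊂ intent′ B))
    ⊎ ((B ≡ extentJ H A N × extentJ H A N ⊂ extent′ A) ×
       (intent′ B ≡ intentJ H N B × intentJ H N B ≡ A))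
    where A = SConcept.ext C
          B = SConcept.int C

-- A concept (A , B) of S is sent to the same concept of K by φ₁ and φ₂ exactly when
-- A'' = B' and A' = B''.  Since A × B ⊆ I, both inclusions A'' ⊆ B' and B'' ⊆ A' hold
-- anyway, and the reverse ones say B' × A' ⊆ I; as A × A' and B' × B lie in I
-- automatically, this is the cross condition (A' ∖ B) × (B' ∖ A) ⊆ I.  The set equality
-- φ₁(S) = φ₂(S) is no weaker than this pointwise equality: an extent of S is recovered
-- from its image as A = A'' ∩ H = B' ∩ H, so φ₂(D) = φ₁(C) forces D = C.  In each of
-- the three cases A' = B or B' = A, so one factor of the cross product is empty.
module Submission where

open import Defs
open import Data.Fin.Subset using (Subset)
open import Data.Product using (_×_)
open import Function.Bundles using (_⇔_)

open import Data.Bool using (Bool; true; false; T; _∧_)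
open import Data.Bool.Properties using (T-≡; T-∧)
open import Data.Empty using (⊥-elim)
open import Data.Fin using (Fin; zero; suc)
open import Data.Nat using (zero; suc)
open import Data.Fin.Subset using (_∈_; _∉_; _⊆_; _─_; inside; outside)
open import Data.Fin.Subset.Properties using (⊆-antisym; p─q⊆p; x∈p∧x∉q⇒x∈p─q; _∈?_)
open import Data.Product using (_,_; proj₁; proj₂)
open import Data.Sum using (inj₁; inj₂)
open import Data.Unit using (tt)
open import Data.Vec using (_∷_; lookup; tabulate; there)
open import Data.Vec.Properties using (lookup∘tabulate; []=⇒lookup; lookup⇒[]=)
open import Function using (_∘_; const)
open import Function.Bundles using (mk⇔; Equivalence)
open import Function.Properties.Equivalence using () renaming (trans to ⇔-trans)
open import Relation.Binary.PropositionalEquality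
  using (_≡_; sym; trans; cong; cong₂; subst)
open import Relation.Nullary using (yes; no)

open Equivalence using (to; from)

T-allFin : ∀ {n} {f : Fin n → Bool} → T (allFin f) ⇔ (∀ x → T (f x))
T-allFin {zero}  = mk⇔ (λ _ ()) (const tt)
T-allFin {suc n} = mk⇔
  (λ t → λ { zero → proj₁ (to T-∧ t) ; (suc x) → to T-allFin (proj₂ (to T-∧ t)) x })
  (λ h → from T-∧ (h zero , from T-allFin (h ∘ suc)))

T-⇒ᵇ : ∀ {a b} → T (a ⇒ᵇ b) ⇔ (T a → T b)
T-⇒ᵇ {true}  = mk⇔ const (λ h → h tt)
T-⇒ᵇ {false} = mk⇔ (λ _ ()) (const tt)

T-lookup : ∀ {n} {p : Subset n} {i} → T (lookup p i) ⇔ i ∈ p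
T-lookup {p = p} {i} = mk⇔ (lookup⇒[]= i p ∘ to T-≡) (from T-≡ ∘ []=⇒lookup)

∈-tabulate : ∀ {n} {f : Fin n → Bool} {i} → i ∈ tabulate f ⇔ T (f i)
∈-tabulate {f = f} {i} = mk⇔
  (λ i∈ → from T-≡ (trans (sym (lookup∘tabulate f i)) ([]=⇒lookup i∈)))
  (λ t → lookup⇒[]= i _ (trans (lookup∘tabulate f i) (to T-≡ t)))

T-allFin-⇒ᵇ : ∀ {n} {p : Subset n} {b : Fin n → Bool} →
  T (allFin λ j → lookup p j ⇒ᵇ b j) ⇔ (∀ j → j ∈ p → T (b j))
T-allFin-⇒ᵇ {p = p} {b} = mk⇔
  (λ t j j∈p → to T-⇒ᵇ (to T-allFin t j) (from T-lookup j∈p))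
  (λ h → from T-allFin λ j → from (T-⇒ᵇ {lookup p j}) λ t → h j (to (T-lookup {p = p}) t))

T-∧³ : ∀ {x y z} → T (x ∧ y ∧ z) ⇔ (T x × T y × T z)
T-∧³ {true}  = mk⇔ (λ t → tt , to T-∧ t) (from T-∧ ∘ proj₂)
T-∧³ {false} = mk⇔ (λ ()) proj₁

x∉p─p : ∀ {n} {x : Fin n} (p : Subset n) → x ∉ p ─ p
x∉p─p (inside  ∷ p) (there x∈) = x∉p─p p x∈
x∉p─p (outside ∷ p) (there x∈) = x∉p─p p x∈

module _ (K : Context) where
  open Context K

  ∈-extent′ : ∀ {A m} → m ∈ extent′ K A ⇔ (∀ g → g ∈ A → m ∈ I g)
  ∈-extent′ {A} {m} = mk⇔
    (λ m∈ g g∈ → to T-lookup (to T-allFin-⇒ᵇ (to ∈-tabulate m∈) g g∈))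
    (λ h → from ∈-tabulate (from T-allFin-⇒ᵇ λ g g∈ → from T-lookup (h g g∈)))

  ∈-intent′ : ∀ {B g} → g ∈ intent′ K B ⇔ (∀ m → m ∈ B → m ∈ I g)
  ∈-intent′ {B} {g} = mk⇔
    (λ g∈ m m∈ → to T-lookup (to T-allFin-⇒ᵇ (to ∈-tabulate g∈) m m∈))
    (λ h → from ∈-tabulate (from T-allFin-⇒ᵇ λ m m∈ → from T-lookup (h m m∈)))

  ∈-extentJ⁻ : ∀ H A N {m} → m ∈ extentJ K H A N → m ∈ N × (∀ g → g ∈ A → m ∈ I g)
  ∈-extentJ⁻ H A N {m} m∈ with to T-∧ (to ∈-tabulate m∈)
  ... | m∈N , t = to T-lookup m∈N , λ g g∈ →
    to T-lookup (proj₂ (proj₂ (to (T-∧³ {lookup H g}) (to T-allFin-⇒ᵇ t g g∈))))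

  ∈-intentJ : ∀ H N B {g} →
    g ∈ intentJ K H N B ⇔ (g ∈ H × (∀ m → m ∈ B → m ∈ N × m ∈ I g))
  ∈-intentJ H N B {g} = mk⇔
    (λ g∈ → let (g∈H , t) = to T-∧ (to ∈-tabulate g∈) in
      to T-lookup g∈H , λ m m∈ →
        let (_ , m∈N , gIm) = to (T-∧³ {lookup H g}) (to T-allFin-⇒ᵇ t m m∈) in
        to T-lookup m∈N , to T-lookup gIm)
    (λ (g∈H , h) → from ∈-tabulate (from T-∧ (from T-lookup g∈H ,
      from T-allFin-⇒ᵇ λ m m∈ → from (T-∧³ {lookup H g})
        (from T-lookup g∈H , from T-lookup (proj₁ (h m m∈)) , from T-lookup (proj₂ (h m m∈))))))

  -- Attribute first, so that CrossCond K (A , B) is literally Preconcept (B' ─ A) (A' ─ B).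
  Preconcept : Subset nG → Subset nM → Set
  Preconcept A B = ∀ m g → m ∈ B → g ∈ A → m ∈ I g

  conceptOfExtent : Subset nG → KPair K
  conceptOfExtent A = intent′ K (extent′ K A) , extent′ K A

  conceptOfIntent : Subset nM → KPair K
  conceptOfIntent B = intent′ K B , extent′ K (intent′ K B)

  extent′-antitone : ∀ {A₁ A₂} → A₁ ⊆ A₂ → extent′ K A₂ ⊆ extent′ K A₁
  extent′-antitone A₁⊆A₂ m∈ = from ∈-extent′ λ g g∈ → to ∈-extent′ m∈ g (A₁⊆A₂ g∈)

  intent′-antitone : ∀ {B₁ B₂} → B₁ ⊆ B₂ → intent′ K B₂ ⊆ intent′ K B₁
  intent′-antitone B₁⊆B₂ g∈ = from ∈-intent′ λ m m∈ → to ∈-intent′ g∈ m (B₁⊆B₂ m∈)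

  preconcept⇒⊆extent′ : ∀ {A B} → Preconcept A B → B ⊆ extent′ K A
  preconcept⇒⊆extent′ AB {m} m∈ = from ∈-extent′ λ g → AB m g m∈

  preconcept⇒⊆intent′ : ∀ {A B} → Preconcept A B → A ⊆ intent′ K B
  preconcept⇒⊆intent′ AB {g} g∈ = from ∈-intent′ λ m m∈ → AB m g m∈ g∈

  preconcept-extent′ : ∀ {A} → Preconcept A (extent′ K A)
  preconcept-extent′ m g m∈ = to ∈-extent′ m∈ g

  conceptOfExtent≡conceptOfIntent⇔ : ∀ {A B} → Preconcept A B →
    conceptOfExtent A ≡ conceptOfIntent B ⇔ Preconcept (intent′ K B) (extent′ K A)
  conceptOfExtent≡conceptOfIntent⇔ {A} {B} AB = mk⇔
    (λ eq m g m∈A′ → preconcept-extent′ m g (subst (m ∈_) (cong proj₂ eq) m∈A′))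
    (λ B′A′ → cong₂ _,_
      (⊆-antisym (intent′-antitone (preconcept⇒⊆extent′ AB)) (preconcept⇒⊆intent′ B′A′))
      (⊆-antisym (preconcept⇒⊆extent′ B′A′) (extent′-antitone (preconcept⇒⊆intent′ AB))))

  preconcept⇔preconcept-─ : ∀ {A B} → Preconcept A B →
    Preconcept (intent′ K B) (extent′ K A) ⇔ Preconcept (intent′ K B ─ A) (extent′ K A ─ B)
  preconcept⇔preconcept-─ {A} {B} AB = mk⇔
    (λ B′A′ m g m∈ g∈ → B′A′ m g (p─q⊆p _ _ m∈) (p─q⊆p _ _ g∈))
    extend
    where
    extend : Preconcept (intent′ K B ─ A) (extent′ K A ─ B) →
             Preconcept (intent′ K B) (extent′ K A)
    extend h m g m∈A′ g∈B′ with g ∈? A | m ∈? B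
    ... | yes g∈A | _       = to ∈-extent′ m∈A′ g g∈A
    ... | no _    | yes m∈B = to ∈-intent′ g∈B′ m m∈B
    ... | no g∉A  | no m∉B  = h m g (x∈p∧x∉q⇒x∈p─q m∈A′ m∉B) (x∈p∧x∉q⇒x∈p─q g∈B′ g∉A)

  extent′≡⇒preconcept-─ : ∀ {A B} → extent′ K A ≡ B →
    Preconcept (intent′ K B ─ A) (extent′ K A ─ B)
  extent′≡⇒preconcept-─ {B = B} A′≡B m _ m∈ _ =
    ⊥-elim (x∉p─p B (subst (λ X → m ∈ X ─ B) A′≡B m∈))

  intent′≡⇒preconcept-─ : ∀ {A B} → intent′ K B ≡ A →
    Preconcept (intent′ K B ─ A) (extent′ K A ─ B)
  intent′≡⇒preconcept-─ {A} B′≡A _ g _ g∈ =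
    ⊥-elim (x∉p─p A (subst (λ X → g ∈ X ─ A) B′≡A g∈))

  module _ {H N} (C : SConcept K H N) where
    open SConcept C renaming (ext to A; int to B)

    ∈-ext : ∀ {g} → g ∈ A ⇔ (g ∈ H × g ∈ intent′ K B)
    ∈-ext = mk⇔
      (λ g∈A → let (g∈H , h) = to (∈-intentJ H N B) (subst (_ ∈_) (sym int-J) g∈A) in
        g∈H , from ∈-intent′ λ m m∈ → proj₂ (h m m∈))
      (λ (g∈H , g∈B′) → subst (_ ∈_) int-J (from (∈-intentJ H N B) (g∈H , λ m m∈ →
        int⊆N m∈ , to ∈-intent′ g∈B′ m m∈)))
      where
      int⊆N : B ⊆ N
      int⊆N m∈ = proj₁ (∈-extentJ⁻ H A N (subst (_ ∈_) (sym ext-J) m∈))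

    sconcept-preconcept : Preconcept A B
    sconcept-preconcept m g m∈ = proj₂ (∈-extentJ⁻ H A N (subst (m ∈_) (sym ext-J) m∈)) g

    ∈-ext-closure : ∀ {g} → g ∈ A ⇔ (g ∈ H × g ∈ intent′ K (extent′ K A))
    ∈-ext-closure = mk⇔
      (λ g∈A → proj₁ (to ∈-ext g∈A) , preconcept⇒⊆intent′ preconcept-extent′ g∈A)
      (λ (g∈H , g∈A″) → from ∈-ext
        (g∈H , intent′-antitone (preconcept⇒⊆extent′ sconcept-preconcept) g∈A″))

  φ₂≡φ₁⇒ext≡ : ∀ {H N} (C D : SConcept K H N) → φ₂ K D ≡ φ₁ K C →
    SConcept.ext D ≡ SConcept.ext C
  φ₂≡φ₁⇒ext≡ C D eq = ⊆-antisym
    (λ g∈D → let (g∈H , g∈B′) = to (∈-ext D) g∈D in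
      from (∈-ext-closure C) (g∈H , subst (_ ∈_) (cong proj₁ eq) g∈B′))
    (λ g∈C → let (g∈H , g∈A″) = to (∈-ext-closure C) g∈C in
      from (∈-ext D) (g∈H , subst (_ ∈_) (sym (cong proj₁ eq)) g∈A″))

  φ₂≡φ₁⇒φ₁≡φ₂ : ∀ {H N} (C D : SConcept K H N) → φ₂ K D ≡ φ₁ K C → φ₁ K D ≡ φ₂ K D
  φ₂≡φ₁⇒φ₁≡φ₂ C D eq = trans (cong conceptOfExtent (φ₂≡φ₁⇒ext≡ C D eq)) (sym eq)

  φ₁S≡φ₂S⇔φ₁≡φ₂ : ∀ {H N} → φ₁S≡φ₂S K H N ⇔ ((C : SConcept K H N) → φ₁ K C ≡ φ₂ K C)
  φ₁S≡φ₂S⇔φ₁≡φ₂ = mk⇔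
    (λ (_ , φ₂⊆φ₁) D → φ₂≡φ₁⇒φ₁≡φ₂ (proj₁ (φ₂⊆φ₁ D)) D (proj₂ (φ₂⊆φ₁ D)))
    (λ φ₁≡φ₂ → (λ C → C , φ₁≡φ₂ C) , (λ C → C , sym (φ₁≡φ₂ C)))

  φ₁≡φ₂⇔crossCond : ∀ {H N} (C : SConcept K H N) → φ₁ K C ≡ φ₂ K C ⇔ CrossCond K C
  φ₁≡φ₂⇔crossCond C = ⇔-trans
    (conceptOfExtent≡conceptOfIntent⇔ (sconcept-preconcept C))
    (preconcept⇔preconcept-─ (sconcept-preconcept C))

  threeCases⇒crossCond : ∀ {H N} (C : SConcept K H N) → ThreeCases K C → CrossCond K C
  threeCases⇒crossCond C (inj₁ (A′≡Aᴶ , Aᴶ≡B , _)) =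
    extent′≡⇒preconcept-─ (trans A′≡Aᴶ Aᴶ≡B)
  threeCases⇒crossCond C (inj₂ (inj₁ ((A′≡Aᴶ , Aᴶ≡B) , _))) =
    extent′≡⇒preconcept-─ (trans A′≡Aᴶ Aᴶ≡B)
  threeCases⇒crossCond C (inj₂ (inj₂ (_ , B′≡Bᴶ , Bᴶ≡A))) =
    intent′≡⇒preconcept-─ (trans B′≡Bᴶ Bᴶ≡A)

lemma10 : (K : Context) (H : Subset (Context.nG K)) (N : Subset (Context.nM K)) →
    (φ₁S≡φ₂S K H N ⇔ ((C : SConcept K H N) → CrossCond K C)) ×
    (((C : SConcept K H N) → ThreeCases K C) → φ₁S≡φ₂S K H N)
lemma10 K H N = ⇔-trans (φ₁S≡φ₂S⇔φ₁≡φ₂ K) pointwise , λ cases →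
  from (φ₁S≡φ₂S⇔φ₁≡φ₂ K) λ C →
    from (φ₁≡φ₂⇔crossCond K C) (threeCases⇒crossCond K C (cases C))
  where
  pointwise : ((C : SConcept K H N) → φ₁ K C ≡ φ₂ K C) ⇔ ((C : SConcept K H N) → CrossCond K C)
  pointwise = mk⇔ (λ φ₁≡φ₂ C → to (φ₁≡φ₂⇔crossCond K C) (φ₁≡φ₂ C))
                  (λ cross C → from (φ₁≡φ₂⇔crossCond K C) (cross C))
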